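{- For every residue function $\tilde r:\mathbb{N}_{>1}\to\mathbb{N}$, the $\mathcal{L}$-theory $T_{\tilde r}$ is consistent.
   Context: $\mathbb{N}=\{0,1,2,\dots\}$, $\mathbb{P}$ the primes. Let $\mathcal{L}=\{\subseteq,\bot,\mathrm{At},\lhd\}$ be the first-order language with binary relation symbols $\subseteq,\lhd$, a constant $\bot$ and a unary relation symbol $\mathrm{At}$. Lowercase variables range over atoms; $X(x)$ abbreviates $x\subseteq X$. $T_{\mathrm{base}}$ states: $\subseteq$ is an atomic Boolean algebra order (one-element algebra allowed); $\lhd$ linearly orders the atoms; $\bot$ is least; $\mathrm{At}$ holds exactly of atoms; $\forall X\forall Y(X\lhd Y\leftrightarrow\exists x\exists y(X(x)\wedge Y(y)\wedge x\lhd y))$; and for every $\mathcal{L}$-formula $\eta(x;\bar Y)$, $\forall\bar Y\exists X\forall x(X(x)\leftrightarrow\eta(x;\bar Y))$. $T_{\mathrm{MSO(Fin)}}$ is $T_{\mathrm{base}}$ plus: the order on atoms is discrete with endpoints, and every $X\neq\bot$ contains a $\lhd$-least atom; $0,0^*$ denote the least and greatest atoms. For $d\ge1$ and $1\le h\le d$, $\rho_{d,h}$ says: there exist non-bottom $A_1,\dots,A_d$ partitioning the atoms with $A_1(0)$; for every atom $a\neq0^*$ and $1\le i\le d$, $A_i(a)$ implies $A_{i'}(a')$ where $a'$ is the immediate successor of $a$ and $i'=i+1$ if $i<d$, $i'=1$ if $i=d$; and $A_h(0^*)$. For any integer $h$, $\rho_{d,h}$ means $\rho_{d,h'}$ with $h'\in\{1,\dots,d\}$,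 $h'\equiv h\pmod d$. $\psi_{>n}$ says there are at least $n+1$ atoms; $T_\infty=\{\psi_{>n}:n\in\mathbb{N}\}$. A function $\tilde r:\mathbb{N}_{>1}\to\mathbb{N}$ is a residue function if there is $r:\mathbb{P}\times\mathbb{N}_{>0}\to\mathbb{N}$ with $r(p,j)<p^j$, $r(p,j+1)\equiv r(p,j)\pmod{p^j}$, such that $\tilde r(d)<d$ and $\tilde r(d)\equiv r(p,j)\pmod{p^j}$ whenever $p^j\mid d$. $T_{\tilde r}=T_{\mathrm{MSO(Fin)}}\cup T_\infty\cup\{\rho_{d,\tilde r(d)}:d\in\mathbb{N}_{>1}\}$. -}

module Defs where

open import Data.Nat using (ℕ; zero; suc; _+_; _*_; _^_; _<_)
open import Data.Nat.Primality using (Prime)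
open import Data.Nat.Divisibility using (_∣_)
open import Data.Nat.DivMod using (_mod_)
open import Data.Fin using (Fin; zero; suc; _↑ʳ_; punchIn; toℕ; #_)
open import Data.List using (List; []; _∷_; map)
open import Data.List.Membership.Propositional using (_∈_)
open import Data.Product using (Σ; ∃; _×_; _,_)
open import Data.Sum using (_⊎_)
open import Relation.Binary.PropositionalEquality using (_≡_)
open import Relation.Nullary using (¬_)

-- First-order syntax of the language L = {⊆, ⊥, At, ◁} (with equality),
-- well-scoped de Bruijn representation: Fm n = formulas with free
-- variables among Fin n (var zero = most recently bound variable).

data Term (n : ℕ) : Set where
  var : Fin n → Term n
  bot : Term n

infix  7 _⊑_ _◁_ _≐_
infixr 6 _∧'_
infixr 5 _∨'_
infixr 4 _⇒_ _⇔_

data Fm (n : ℕ) : Set where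
  ff   : Fm n
  _⊑_  : Term n → Term n → Fm n
  _◁_  : Term n → Term n → Fm n
  _≐_  : Term n → Term n → Fm n
  At   : Term n → Fm n
  _⇒_  : Fm n → Fm n → Fm n
  _∧'_ : Fm n → Fm n → Fm n
  _∨'_ : Fm n → Fm n → Fm n
  ∀'   : Fm (suc n) → Fm n
  ∃'   : Fm (suc n) → Fm n

¬' : ∀ {n} → Fm n → Fm n
¬' φ = φ ⇒ ff

tt' : ∀ {n} → Fm n
tt' = ff ⇒ ff

_⇔_ : ∀ {n} → Fm n → Fm n → Fm n
φ ⇔ ψ = (φ ⇒ ψ) ∧' (ψ ⇒ φ)

liftR : ∀ {n m} → (Fin n → Fin m) → Fin (suc n) → Fin (suc m)
liftR ρ zero    = zero
liftR ρ (suc i) = suc (ρ i)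

renT : ∀ {n m} → (Fin n → Fin m) → Term n → Term m
renT ρ (var i) = var (ρ i)
renT ρ bot     = bot

ren : ∀ {n m} → (Fin n → Fin m) → Fm n → Fm m
ren ρ ff        = ff
ren ρ (s ⊑ t)   = renT ρ s ⊑ renT ρ t
ren ρ (s ◁ t)   = renT ρ s ◁ renT ρ t
ren ρ (s ≐ t)   = renT ρ s ≐ renT ρ t
ren ρ (At t)    = At (renT ρ t)
ren ρ (φ ⇒ ψ)   = ren ρ φ ⇒ ren ρ ψ
ren ρ (φ ∧' ψ)  = ren ρ φ ∧' ren ρ ψ
ren ρ (φ ∨' ψ)  = ren ρ φ ∨' ren ρ ψ
ren ρ (∀' φ)    = ∀' (ren (liftR ρ) φ)
ren ρ (∃' φ)    = ∃' (ren (liftR ρ) φ)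

wkT : ∀ {n} → Term n → Term (suc n)
wkT = renT suc

wk : ∀ {n} → Fm n → Fm (suc n)
wk = ren suc

liftS : ∀ {n m} → (Fin n → Term m) → Fin (suc n) → Term (suc m)
liftS σ zero    = var zero
liftS σ (suc i) = wkT (σ i)

subT : ∀ {n m} → (Fin n → Term m) → Term n → Term m
subT σ (var i) = σ i
subT σ bot     = bot

sub : ∀ {n m} → (Fin n → Term m) → Fm n → Fm m
sub σ ff        = ff
sub σ (s ⊑ t)   = subT σ s ⊑ subT σ t
sub σ (s ◁ t)   = subT σ s ◁ subT σ t
sub σ (s ≐ t)   = subT σ s ≐ subT σ t
sub σ (At t)    = At (subT σ t)
sub σ (φ ⇒ ψ)   = sub σ φ ⇒ sub σ ψ
sub σ (φ ∧' ψ)  = sub σ φ ∧' sub σ ψ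
sub σ (φ ∨' ψ)  = sub σ φ ∨' sub σ ψ
sub σ (∀' φ)    = ∀' (sub (liftS σ) φ)
sub σ (∃' φ)    = ∃' (sub (liftS σ) φ)

sub0 : ∀ {n} → Term n → Fin (suc n) → Term n
sub0 t zero    = t
sub0 t (suc i) = var i

_[_] : ∀ {n} → Fm (suc n) → Term n → Fm n
φ [ t ] = sub (sub0 t) φ

emb : ∀ {n} → Fm 0 → Fm n
emb = ren (λ ())

closeAll : (k : ℕ) → Fm k → Fm 0
closeAll zero    φ = φ
closeAll (suc k) φ = closeAll k (∀' φ)

exAll : (k : ℕ) → Fm k → Fm 0
exAll zero    φ = φ
exAll (suc k) φ = exAll k (∃' φ)

⋀ : ∀ {d n} → (Fin d → Fm n) → Fm n
⋀ {zero}  f = tt'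
⋀ {suc d} f = f zero ∧' ⋀ (λ i → f (suc i))

⋁ : ∀ {d n} → (Fin d → Fm n) → Fm n
⋁ {zero}  f = ff
⋁ {suc d} f = f zero ∨' ⋁ (λ i → f (suc i))

-- quantifiers relativised to atoms ("lowercase variables")
∀a : ∀ {n} → Fm (suc n) → Fm n
∀a φ = ∀' (At (var zero) ⇒ φ)

∃a : ∀ {n} → Fm (suc n) → Fm n
∃a φ = ∃' (At (var zero) ∧' φ)

Theory : Set₁
Theory = Fm 0 → Set

infix 2 _∣_⊢_

data _∣_⊢_ (T : Theory) : ∀ {n} → List (Fm n) → Fm n → Set where
  hyp   : ∀ {n} {Γ : List (Fm n)} {φ} → φ ∈ Γ → T ∣ Γ ⊢ φ
  axiom : ∀ {n} {Γ : List (Fm n)} {ψ} → T ψ → T ∣ Γ ⊢ emb ψ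
  raa   : ∀ {n} {Γ : List (Fm n)} {φ} → T ∣ ¬' φ ∷ Γ ⊢ ff → T ∣ Γ ⊢ φ
  ⇒I    : ∀ {n} {Γ : List (Fm n)} {φ ψ} → T ∣ φ ∷ Γ ⊢ ψ → T ∣ Γ ⊢ φ ⇒ ψ
  ⇒E    : ∀ {n} {Γ : List (Fm n)} {φ ψ} → T ∣ Γ ⊢ φ ⇒ ψ → T ∣ Γ ⊢ φ → T ∣ Γ ⊢ ψ
  ∧I    : ∀ {n} {Γ : List (Fm n)} {φ ψ} → T ∣ Γ ⊢ φ → T ∣ Γ ⊢ ψ → T ∣ Γ ⊢ φ ∧' ψ
  ∧E₁   : ∀ {n} {Γ : List (Fm n)} {φ ψ} → T ∣ Γ ⊢ φ ∧' ψ → T ∣ Γ ⊢ φ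
  ∧E₂   : ∀ {n} {Γ : List (Fm n)} {φ ψ} → T ∣ Γ ⊢ φ ∧' ψ → T ∣ Γ ⊢ ψ
  ∨I₁   : ∀ {n} {Γ : List (Fm n)} {φ ψ} → T ∣ Γ ⊢ φ → T ∣ Γ ⊢ φ ∨' ψ
  ∨I₂   : ∀ {n} {Γ : List (Fm n)} {φ ψ} → T ∣ Γ ⊢ ψ → T ∣ Γ ⊢ φ ∨' ψ
  ∨E    : ∀ {n} {Γ : List (Fm n)} {φ ψ χ} → T ∣ Γ ⊢ φ ∨' ψ →
          T ∣ φ ∷ Γ ⊢ χ → T ∣ ψ ∷ Γ ⊢ χ → T ∣ Γ ⊢ χ
  ∀I    : ∀ {n} {Γ : List (Fm n)} {φ} → T ∣ map wk Γ ⊢ φ → T ∣ Γ ⊢ ∀' φ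
  ∀E    : ∀ {n} {Γ : List (Fm n)} {φ} → T ∣ Γ ⊢ ∀' φ → (t : Term n) → T ∣ Γ ⊢ φ [ t ]
  ∃I    : ∀ {n} {Γ : List (Fm n)} {φ} → (t : Term n) → T ∣ Γ ⊢ φ [ t ] → T ∣ Γ ⊢ ∃' φ
  ∃E    : ∀ {n} {Γ : List (Fm n)} {φ ψ} → T ∣ Γ ⊢ ∃' φ →
          T ∣ φ ∷ map wk Γ ⊢ wk ψ → T ∣ Γ ⊢ ψ
  ≐refl : ∀ {n} {Γ : List (Fm n)} (t : Term n) → T ∣ Γ ⊢ t ≐ t
  ≐E    : ∀ {n} {Γ : List (Fm n)} {s t : Term n} (φ : Fm (suc n)) →
          T ∣ Γ ⊢ s ≐ t → T ∣ Γ ⊢ φ [ s ] → T ∣ Γ ⊢ φ [ t ]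

Consistent : Theory → Set
Consistent T = ¬ (T ∣ ([] {A = Fm 0}) ⊢ ff)

x0 : ∀ {n} → Term (suc n)
x0 = var zero
x1 : ∀ {n} → Term (suc (suc n))
x1 = var (suc zero)
x2 : ∀ {n} → Term (suc (suc (suc n)))
x2 = var (suc (suc zero))
x3 : ∀ {n} → Term (suc (suc (suc (suc n))))
x3 = var (suc (suc (suc zero)))

isMeet : ∀ {n} → Term n → Term n → Term n → Fm n
isMeet a b c = c ⊑ a ∧' c ⊑ b ∧'
  ∀' ((x0 ⊑ wkT a ∧' x0 ⊑ wkT b) ⇒ x0 ⊑ wkT c)

isJoin : ∀ {n} → Term n → Term n → Term n → Fm n
isJoin a b c = a ⊑ c ∧' b ⊑ c ∧'
  ∀' ((wkT a ⊑ x0 ∧' wkT b ⊑ x0) ⇒ wkT c ⊑ x0)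

isTop : ∀ {n} → Term n → Fm n
isTop t = ∀' (x0 ⊑ wkT t)

isAtom : ∀ {n} → Term n → Fm n
isAtom t = ¬' (t ≐ bot) ∧' ∀' (x0 ⊑ wkT t ⇒ (x0 ≐ bot ∨' x0 ≐ wkT t))

isLeast : ∀ {n} → Term n → Fm n
isLeast t = At t ∧' ∀a (x0 ≐ wkT t ∨' wkT t ◁ x0)

isGreatest : ∀ {n} → Term n → Fm n
isGreatest t = At t ∧' ∀a (x0 ≐ wkT t ∨' x0 ◁ wkT t)

isSucc : ∀ {n} → Term n → Term n → Fm n
isSucc a b = At a ∧' At b ∧' a ◁ b ∧' ∀a (¬' (wkT a ◁ x0 ∧' x0 ◁ wkT b))

ax-refl ax-antisym ax-trans : Fm 0
ax-refl    = ∀' (x0 ⊑ x0)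
ax-antisym = ∀' (∀' ((x1 ⊑ x0 ∧' x0 ⊑ x1) ⇒ x1 ≐ x0))
ax-trans   = ∀' (∀' (∀' ((x2 ⊑ x1 ∧' x1 ⊑ x0) ⇒ x2 ⊑ x0)))

ax-meet ax-join ax-top ax-bot : Fm 0
ax-meet = ∀' (∀' (∃' (isMeet x2 x1 x0)))
ax-join = ∀' (∀' (∃' (isJoin x2 x1 x0)))
ax-top  = ∃' (isTop x0)
ax-bot  = ∀' (bot ⊑ x0)

-- distributivity: X ∧ (Y ∨ Z) = (X ∧ Y) ∨ (X ∧ Z)
-- variables: X=7, Y=6, Z=5, J=4, M=3, M1=2, M2=1, J2=0
ax-distr : Fm 0
ax-distr = closeAll 8
  ((isJoin (var (# 6)) (var (# 5)) (var (# 4)) ∧'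
    isMeet (var (# 7)) (var (# 4)) (var (# 3)) ∧'
    isMeet (var (# 7)) (var (# 6)) (var (# 2)) ∧'
    isMeet (var (# 7)) (var (# 5)) (var (# 1)) ∧'
    isJoin (var (# 2)) (var (# 1)) (var (# 0)))
   ⇒ var (# 3) ≐ var (# 0))

ax-compl : Fm 0
ax-compl = ∀' (∃' (isMeet x1 x0 bot ∧' ∃' (isTop x0 ∧' isJoin x2 x1 x0)))

ax-atomic : Fm 0
ax-atomic = ∀' (¬' (x0 ≐ bot) ⇒ ∃' (isAtom x0 ∧' x0 ⊑ x1))

ax-At : Fm 0
ax-At = ∀' (At x0 ⇔ isAtom x0)

ax-irrefl ax-ltrans ax-total : Fm 0
ax-irrefl = ∀a (¬' (x0 ◁ x0))
ax-ltrans = ∀a (∀a (∀a ((x2 ◁ x1 ∧' x1 ◁ x0) ⇒ x2 ◁ x0)))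
ax-total  = ∀a (∀a (x1 ◁ x0 ∨' x1 ≐ x0 ∨' x0 ◁ x1))

ax-lift : Fm 0
ax-lift = ∀' (∀' (x1 ◁ x0 ⇔ ∃a (∃a (x1 ⊑ x3 ∧' x0 ⊑ x2 ∧' x1 ◁ x0))))

-- comprehension for η(x; Y₁..Y_k) : Fm (suc k), x = var zero:
--   ∀Ȳ ∃X ∀x (X(x) ↔ η(x; Ȳ))
compRen : ∀ {k} → Fin (suc k) → Fin (suc (suc k))
compRen zero    = zero
compRen (suc i) = suc (suc i)

comprehension : (k : ℕ) → Fm (suc k) → Fm 0
comprehension k η = closeAll k (∃' (∀a (x0 ⊑ x1 ⇔ ren compRen η)))

data T-base : Theory where
  b-refl    : T-base ax-refl
  b-antisym : T-base ax-antisym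
  b-trans   : T-base ax-trans
  b-meet    : T-base ax-meet
  b-join    : T-base ax-join
  b-top     : T-base ax-top
  b-bot     : T-base ax-bot
  b-distr   : T-base ax-distr
  b-compl   : T-base ax-compl
  b-atomic  : T-base ax-atomic
  b-At      : T-base ax-At
  b-irrefl  : T-base ax-irrefl
  b-ltrans  : T-base ax-ltrans
  b-total   : T-base ax-total
  b-lift    : T-base ax-lift
  b-comp    : (k : ℕ) (η : Fm (suc k)) → T-base (comprehension k η)

ax-least ax-greatest ax-succ ax-pred ax-wf : Fm 0
ax-least    = ∃' (isLeast x0)
ax-greatest = ∃' (isGreatest x0)
ax-succ     = ∀a (∃a (x1 ◁ x0) ⇒ ∃' (isSucc x1 x0))
ax-pred     = ∀a (∃a (x0 ◁ x1) ⇒ ∃' (isSucc x0 x1))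
ax-wf       = ∀' (¬' (x0 ≐ bot) ⇒
                ∃a (x0 ⊑ x1 ∧' ∀a (x0 ⊑ x2 ⇒ (x0 ≐ x1 ∨' x1 ◁ x0))))

data T-MSOFin : Theory where
  m-base     : ∀ {φ} → T-base φ → T-MSOFin φ
  m-least    : T-MSOFin ax-least
  m-greatest : T-MSOFin ax-greatest
  m-succ     : T-MSOFin ax-succ
  m-pred     : T-MSOFin ax-pred
  m-wf       : T-MSOFin ax-wf

-- ρ_{d,h} for d = suc m.  The sets A₁..A_d are the variables
-- var i (i : Fin d), A_{i+1} ↔ index i.  The index of A_{h'} with
-- h' ∈ {1..d}, h' ≡ h (mod d) is (h + m) mod d.

nextIdx : ∀ {m} → Fin (suc m) → Fin (suc m)
nextIdx {m} i = suc (toℕ i) mod suc m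

rhoIdx : (m h : ℕ) → Fin (suc m)
rhoIdx m h = (h + m) mod suc m

rho : (m h : ℕ) → Fm 0
rho m h = exAll (suc m)
  (⋀ (λ i → ¬' (A0 i ≐ bot))
   ∧' ∀a (⋁ (λ i → x0 ⊑ A1 i))
   ∧' ∀a (⋀ (λ i → ⋀ (λ j → ¬' (x0 ⊑ A1 i ∧' x0 ⊑ A1 (punchIn i j)))))
   ∧' ∀' (isLeast x0 ⇒ x0 ⊑ A1 zero)
   ∧' ∀a (∀a (isSucc x1 x0 ⇒ ⋀ (λ i → x1 ⊑ A2 i ⇒ x0 ⊑ A2 (nextIdx i))))
   ∧' ∀' (isGreatest x0 ⇒ x0 ⊑ A1 (rhoIdx m h)))
  where
  A0 : Fin (suc m) → Term (suc m)
  A0 i = var i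
  A1 : Fin (suc m) → Term (suc (suc m))
  A1 i = var (1 ↑ʳ i)
  A2 : Fin (suc m) → Term (suc (suc (suc m)))
  A2 i = var (2 ↑ʳ i)

atLeast : ℕ → Fm 0
atLeast n = exAll (suc n)
  (⋀ (λ i → At (var i)) ∧'
   ⋀ (λ i → ⋀ (λ j → ¬' (var i ≐ var (punchIn i j)))))

-- Residue functions.  r̃ : ℕ_{>1} → ℕ is represented by rt : ℕ → ℕ
-- (values at 0 and 1 are irrelevant); r : ℙ × ℕ_{>0} → ℕ by a function
-- ℕ → ℕ → ℕ constrained only at primes p and j > 0.

ModEq : ℕ → ℕ → ℕ → Set
ModEq m a b = ∃ λ k → (a ≡ b + k * m) ⊎ (b ≡ a + k * m)

IsResidueFunction : (ℕ → ℕ) → Set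
IsResidueFunction rt = Σ (ℕ → ℕ → ℕ) λ r →
  (∀ p j → Prime p → 0 < j → r p j < p ^ j) ×
  (∀ p j → Prime p → 0 < j → ModEq (p ^ j) (r p (suc j)) (r p j)) ×
  (∀ d → 1 < d → rt d < d) ×
  (∀ d p j → 1 < d → Prime p → 0 < j → p ^ j ∣ d → ModEq (p ^ j) (rt d) (r p j))

data T-res (rt : ℕ → ℕ) : Theory where
  t-mso : ∀ {φ} → T-MSOFin φ → T-res rt φ
  t-inf : (n : ℕ) → T-res rt (atLeast n)
  t-rho : (k : ℕ) → T-res rt (rho (suc k) (rt (suc (suc k))))

-- A derivation of ⊥ from T_r̃ uses only finitely many axioms, so it suffices to give, for every
-- bound B, a model of the axioms of rank at most B. The power set of an N-element chain satisfies
-- T_MSO(Fin) and ψ_{>n} for n < N, and colouring its atoms cyclically with d colours shows that it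
-- satisfies ρ_{d,h} as soon as d ≤ N and N ≡ h (mod d). Taking N = r̃(D) + D with D = (B+2)! gives
-- N ≡ r̃(D) ≡ r̃(d) (mod d) for all d ≤ B+2: modulo each prime power p^j dividing d, both r̃(D) and
-- r̃(d) are congruent to r(p,j), and these prime powers determine divisibility by d.

module Submission where

open import Defs hiding (_⇔_)
open import Data.Nat
open import Data.Nat.Properties
open import Data.Nat.DivMod
open import Data.Nat.Divisibility
open import Data.Nat.Primality
open import Data.Nat.Coprimality using (Coprime; coprime-divisor)
open import Data.Nat.Primality.Factorisation using (factorise; PrimeFactorisation)
open import Data.Nat.ListAction using (product)
import Data.Bool.Properties as Bool
open import Data.Fin as Fin using (Fin; zero; suc; toℕ)
import Data.Fin.Properties as Fin
open import Data.Fin.Subset using (Subset; ⁅_⁆; _∈_; _⊆_; _∩_; _∪_; ∁; ⊤; Nonempty; inside; outside)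
  renaming (⊥ to ∅)
open import Data.Fin.Subset.Properties
open import Data.Vec using (Vec; []; _∷_; lookup; tabulate; here; there)
open import Data.Vec.Properties using (≡-dec; lookup∘tabulate; []=⇒lookup; lookup⇒[]=)
open import Data.List using (List; []; _∷_; map)
open import Data.List.Relation.Unary.All as All using (All; []; _∷_)
open import Data.List.Relation.Unary.All.Properties using (map⁺)
open import Data.Product as Product using (Σ; ∃; ∃₂; ∃-syntax; _×_; _,_; proj₁; proj₂)
open import Data.Product.Function.NonDependent.Propositional using (_×-⇔_)
open import Data.Sum as Sum using (_⊎_; inj₁; inj₂; [_,_]′)
open import Data.Sum.Function.Propositional using (_⊎-⇔_)
open import Data.Empty using (⊥)
open import Function using (_⇔_; mk⇔; Equivalence; _∘_)
open import Function.Construct.Identity using (⇔-id)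
import Function.Properties.Equivalence as ⇔
open import Function.Related.Propositional using (≡⇒)
open import Function.Related.TypeIsomorphisms using (→-cong-⇔)
open import Level using (0ℓ)
open import Relation.Nullary using (Dec; yes; no; ¬_; ¬?; contradiction)
open import Relation.Nullary.Decidable
  using (_×-dec_; _⊎-dec_; _→-dec_; decidable-stable; isYes; toWitness; fromWitness)
open import Relation.Unary as U using (Pred)
open import Relation.Binary using (Rel; Decidable; DecidableEquality; tri<; tri≈; tri>)
open import Relation.Binary.PropositionalEquality hiding ([_])

-- Arithmetic of residue functions

prime∣^⇒∣ : ∀ {p q} j → Prime p → p ∣ q ^ j → p ∣ q
prime∣^⇒∣ zero p-prime p∣1 = contradiction (subst Prime (∣1⇒≡1 p∣1) p-prime) ¬prime[1]
prime∣^⇒∣ {q = q} (suc j) p-prime p∣q*q^j with euclidsLemma q (q ^ j) p-prime p∣q*q^j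
... | inj₁ p∣q   = p∣q
... | inj₂ p∣q^j = prime∣^⇒∣ j p-prime p∣q^j

^-coprime : ∀ {p q} j → Prime p → Prime q → q ≢ p → Coprime (q ^ j) p
^-coprime j p-prime q-prime q≢p (i∣q^j , i∣p) with prime⇒irreducible p-prime i∣p
... | inj₁ i≡1 = i≡1
... | inj₂ refl with prime⇒irreducible q-prime (prime∣^⇒∣ j p-prime i∣q^j)
...   | inj₁ p≡1 = contradiction (subst Prime p≡1 p-prime) ¬prime[1]
...   | inj₂ p≡q = contradiction (sym p≡q) q≢p

infix 4 _∣ᵖ_

_∣ᵖ_ : ℕ → ℕ → Set
d ∣ᵖ c = ∀ p j → Prime p → 0 < j → p ^ j ∣ d → p ^ j ∣ c

product-∣ : ∀ {ps c} → All Prime ps → product ps ∣ᵖ c → product ps ∣ c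
product-∣ {[]} [] _ = 1∣ _
product-∣ {p ∷ ps} {c} (p-prime ∷ ps-prime) ps∣ᵖc =
  subst (p * product ps ∣_) (sym c≡p*c′) (*-monoʳ-∣ p (product-∣ ps-prime ps∣ᵖc′))
  where
  p∣c : p ∣ c
  p∣c = subst (_∣ c) (*-identityʳ p)
          (ps∣ᵖc p 1 p-prime (s≤s z≤n) (subst (_∣ p * product ps) (sym (*-identityʳ p)) (m∣m*n (product ps))))
  c′ : ℕ
  c′ = quotient p∣c
  c≡p*c′ : c ≡ p * c′
  c≡p*c′ = m∣n⇒n≡m*quotient p∣c
  ps∣ᵖc′ : product ps ∣ᵖ c′
  ps∣ᵖc′ q j q-prime 0<j q^j∣ps with q ≟ p
  ... | yes refl = *-cancelˡ-∣ q {{prime⇒nonZero q-prime}}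
                     (subst (q ^ suc j ∣_) c≡p*c′ (ps∣ᵖc q (suc j) q-prime (s≤s z≤n) (*-monoʳ-∣ q q^j∣ps)))
  ... | no q≢p   = coprime-divisor (^-coprime j p-prime q-prime q≢p)
                     (subst (q ^ j ∣_) c≡p*c′ (ps∣ᵖc q j q-prime 0<j (∣-trans q^j∣ps (n∣m*n p))))

∣ᵖ⇒∣ : ∀ {d c} .{{_ : NonZero d}} → d ∣ᵖ c → d ∣ c
∣ᵖ⇒∣ {d} d∣ᵖc = subst (_∣ _) (sym isFactorisation)
  (product-∣ factorsPrime (λ p j pp 0<j → d∣ᵖc p j pp 0<j ∘ subst (_ ∣_) (sym isFactorisation)))
  where open PrimeFactorisation (factorise d)

ModEq⇒%≡ : ∀ {q a b} .{{_ : NonZero q}} → ModEq q a b → a % q ≡ b % q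
ModEq⇒%≡ {q} {b = b} (k , inj₁ refl) = [m+kn]%n≡m%n b k q
ModEq⇒%≡ {q} {a}     (k , inj₂ refl) = sym ([m+kn]%n≡m%n a k q)

%≡⇒∣∸ : ∀ {q a b} .{{_ : NonZero q}} → a % q ≡ b % q → q ∣ a ∸ b
%≡⇒∣∸ {q} {a} {b} a≡b = divides (a / q ∸ b / q) (begin
  a ∸ b                                     ≡⟨ cong₂ _∸_ (m≡m%n+[m/n]*n a q) (m≡m%n+[m/n]*n b q) ⟩
  (a % q + a / q * q) ∸ (b % q + b / q * q) ≡⟨ cong (λ r → (a % q + a / q * q) ∸ (r + b / q * q)) (sym a≡b) ⟩
  (a % q + a / q * q) ∸ (a % q + b / q * q) ≡⟨ [m+n]∸[m+o]≡n∸o (a % q) _ _ ⟩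
  a / q * q ∸ b / q * q                     ≡⟨ *-distribʳ-∸ q (a / q) (b / q) ⟨
  (a / q ∸ b / q) * q                       ∎)
  where open ≡-Reasoning

∣∸⇒%≡ : ∀ {d a b} .{{_ : NonZero d}} → d ∣ a ∸ b → d ∣ b ∸ a → a % d ≡ b % d
∣∸⇒%≡ {d} {a} {b} d∣a∸b d∣b∸a with ≤-total b a
... | inj₁ b≤a = trans (cong (_% d) (sym (m+[n∸m]≡n b≤a))) (%-remove-+ʳ b d∣a∸b)
... | inj₂ a≤b = sym (trans (cong (_% d) (sym (m+[n∸m]≡n a≤b))) (%-remove-+ʳ a d∣b∸a))

residue-coherent : ∀ {rt} → IsResidueFunction rt →
                   ∀ {d D} .{{_ : NonZero d}} → 1 < d → 1 < D → d ∣ D → rt D % d ≡ rt d % d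
residue-coherent {rt} (r , _ , _ , _ , rt≡r) {d} {D} 1<d 1<D d∣D =
  ∣∸⇒%≡ (∣ᵖ⇒∣ λ p j pp 0<j → proj₁ ∘ agree p j pp 0<j)
        (∣ᵖ⇒∣ λ p j pp 0<j → proj₂ ∘ agree p j pp 0<j)
  where
  agree : ∀ p j → Prime p → 0 < j → p ^ j ∣ d → p ^ j ∣ rt D ∸ rt d × p ^ j ∣ rt d ∸ rt D
  agree p j pp 0<j q∣d = %≡⇒∣∸ D≡d , %≡⇒∣∸ (sym D≡d)
    where
    instance
      p^j≢0 : NonZero (p ^ j)
      p^j≢0 = m^n≢0 p j {{prime⇒nonZero pp}}
    D≡d : rt D % p ^ j ≡ rt d % p ^ j
    D≡d = trans (ModEq⇒%≡ (rt≡r D p j 1<D pp 0<j (∣-trans q∣d d∣D)))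
                (sym (ModEq⇒%≡ (rt≡r d p j 1<d pp 0<j q∣d)))

%-cong-+ˡ : ∀ {a b} c d .{{_ : NonZero d}} → a % d ≡ b % d → (c + a) % d ≡ (c + b) % d
%-cong-+ˡ {a} {b} c d a≡b = begin
  (c + a) % d         ≡⟨ %-distribˡ-+ c a d ⟩
  (c % d + a % d) % d ≡⟨ cong (λ r → (c % d + r) % d) a≡b ⟩
  (c % d + b % d) % d ≡⟨ %-distribˡ-+ c b d ⟨
  (c + b) % d         ∎
  where open ≡-Reasoning

-- Tarski semantics and soundness

-- ∃? makes satisfaction decidable, which is what validates the classical rule raa.
record Structure : Set₁ where
  infix 4 _⊑ᴹ_ _◁ᴹ_
  field
    Carrier    : Set
    ⊥ᴹ         : Carrier
    _⊑ᴹ_ _◁ᴹ_ : Rel Carrier 0ℓ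
    Atᴹ        : Pred Carrier 0ℓ
    _≐?_       : DecidableEquality Carrier
    _⊑?_       : Decidable _⊑ᴹ_
    _◁?_       : Decidable _◁ᴹ_
    At?        : U.Decidable Atᴹ
    ∃?         : ∀ {P : Pred Carrier 0ℓ} → U.Decidable P → Dec (∃ P)

Π-⇔ : ∀ {A : Set} {P Q : A → Set} → (∀ x → P x ⇔ Q x) → (∀ x → P x) ⇔ (∀ x → Q x)
Π-⇔ P⇔Q = mk⇔ (λ f x → Equivalence.to (P⇔Q x) (f x)) (λ f x → Equivalence.from (P⇔Q x) (f x))

Σ-⇔ : ∀ {A : Set} {P Q : A → Set} → (∀ x → P x ⇔ Q x) → Σ A P ⇔ Σ A Q
Σ-⇔ P⇔Q = mk⇔ (λ (x , p) → x , Equivalence.to (P⇔Q x) p) (λ (x , q) → x , Equivalence.from (P⇔Q x) q)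

module Semantics (𝔐 : Structure) where
  open Structure 𝔐

  Env : ℕ → Set
  Env = Vec Carrier

  ⟦_⟧ᵗ : ∀ {n} → Term n → Env n → Carrier
  ⟦ var i ⟧ᵗ ρ = lookup ρ i
  ⟦ bot ⟧ᵗ   ρ = ⊥ᴹ

  ⟦_⟧ : ∀ {n} → Fm n → Env n → Set
  ⟦ ff ⟧     ρ = ⊥
  ⟦ s ⊑ t ⟧  ρ = ⟦ s ⟧ᵗ ρ ⊑ᴹ ⟦ t ⟧ᵗ ρ
  ⟦ s ◁ t ⟧  ρ = ⟦ s ⟧ᵗ ρ ◁ᴹ ⟦ t ⟧ᵗ ρ
  ⟦ s ≐ t ⟧  ρ = ⟦ s ⟧ᵗ ρ ≡ ⟦ t ⟧ᵗ ρ
  ⟦ At t ⟧   ρ = Atᴹ (⟦ t ⟧ᵗ ρ)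
  ⟦ φ ⇒ ψ ⟧  ρ = ⟦ φ ⟧ ρ → ⟦ ψ ⟧ ρ
  ⟦ φ ∧' ψ ⟧ ρ = ⟦ φ ⟧ ρ × ⟦ ψ ⟧ ρ
  ⟦ φ ∨' ψ ⟧ ρ = ⟦ φ ⟧ ρ ⊎ ⟦ ψ ⟧ ρ
  ⟦ ∀' φ ⟧   ρ = ∀ x → ⟦ φ ⟧ (x ∷ ρ)
  ⟦ ∃' φ ⟧   ρ = ∃ λ x → ⟦ φ ⟧ (x ∷ ρ)

  ∀? : ∀ {P : Pred Carrier 0ℓ} → U.Decidable P → Dec (∀ x → P x)
  ∀? P? with ∃? (¬? ∘ P?)
  ... | yes (x , ¬Px) = no λ ∀P → ¬Px (∀P x)
  ... | no ∄¬P        = yes λ x → decidable-stable (P? x) λ ¬Px → ∄¬P (x , ¬Px)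

  ⟦_⟧? : ∀ {n} (φ : Fm n) (ρ : Env n) → Dec (⟦ φ ⟧ ρ)
  ⟦ ff ⟧?     ρ = no λ ()
  ⟦ s ⊑ t ⟧?  ρ = ⟦ s ⟧ᵗ ρ ⊑? ⟦ t ⟧ᵗ ρ
  ⟦ s ◁ t ⟧?  ρ = ⟦ s ⟧ᵗ ρ ◁? ⟦ t ⟧ᵗ ρ
  ⟦ s ≐ t ⟧?  ρ = ⟦ s ⟧ᵗ ρ ≐? ⟦ t ⟧ᵗ ρ
  ⟦ At t ⟧?   ρ = At? (⟦ t ⟧ᵗ ρ)
  ⟦ φ ⇒ ψ ⟧?  ρ = ⟦ φ ⟧? ρ →-dec ⟦ ψ ⟧? ρ
  ⟦ φ ∧' ψ ⟧? ρ = ⟦ φ ⟧? ρ ×-dec ⟦ ψ ⟧? ρ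
  ⟦ φ ∨' ψ ⟧? ρ = ⟦ φ ⟧? ρ ⊎-dec ⟦ ψ ⟧? ρ
  ⟦ ∀' φ ⟧?   ρ = ∀? λ x → ⟦ φ ⟧? (x ∷ ρ)
  ⟦ ∃' φ ⟧?   ρ = ∃? λ x → ⟦ φ ⟧? (x ∷ ρ)

  ⋀-intro : ∀ {d n} (f : Fin d → Fm n) {ρ : Env n} → (∀ i → ⟦ f i ⟧ ρ) → ⟦ ⋀ f ⟧ ρ
  ⋀-intro {zero}  f ⊨f = λ ()
  ⋀-intro {suc d} f ⊨f = ⊨f zero , ⋀-intro (f ∘ suc) (⊨f ∘ suc)

  ⋁-intro : ∀ {d n} (f : Fin d → Fm n) {ρ : Env n} → ∃ (λ i → ⟦ f i ⟧ ρ) → ⟦ ⋁ f ⟧ ρ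
  ⋁-intro f (zero  , ⊨fi) = inj₁ ⊨fi
  ⋁-intro f (suc i , ⊨fi) = inj₂ (⋁-intro (f ∘ suc) (i , ⊨fi))

  closeAll-intro : ∀ k {φ : Fm k} → (∀ ρ → ⟦ φ ⟧ ρ) → ⟦ closeAll k φ ⟧ []
  closeAll-intro zero    ⊨φ = ⊨φ []
  closeAll-intro (suc k) ⊨φ = closeAll-intro k λ ρ x → ⊨φ (x ∷ ρ)

  exAll-intro : ∀ k {φ : Fm k} ρ → ⟦ φ ⟧ ρ → ⟦ exAll k φ ⟧ []
  exAll-intro zero    []      ⊨φ = ⊨φ
  exAll-intro (suc k) (x ∷ ρ) ⊨φ = exAll-intro k ρ (x , ⊨φ)

  ∷-liftR : ∀ {n m} {f : Fin n → Fin m} {ρ : Env m} {ρ′ : Env n} x →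
            lookup ρ ∘ f ≗ lookup ρ′ → lookup (x ∷ ρ) ∘ liftR f ≗ lookup (x ∷ ρ′)
  ∷-liftR x h zero    = refl
  ∷-liftR x h (suc i) = h i

  ⟦renT⟧ : ∀ {n m} (f : Fin n → Fin m) {ρ : Env m} {ρ′ : Env n} →
           lookup ρ ∘ f ≗ lookup ρ′ → ∀ t → ⟦ renT f t ⟧ᵗ ρ ≡ ⟦ t ⟧ᵗ ρ′
  ⟦renT⟧ f ρ∘f≗ρ′ (var i) = ρ∘f≗ρ′ i
  ⟦renT⟧ f ρ∘f≗ρ′ bot     = refl

  ⟦ren⟧ : ∀ {n m} (f : Fin n → Fin m) {ρ : Env m} {ρ′ : Env n} →
          lookup ρ ∘ f ≗ lookup ρ′ → ∀ φ → ⟦ ren f φ ⟧ ρ ⇔ ⟦ φ ⟧ ρ′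
  ⟦ren⟧ f h ff = ⇔-id _
  ⟦ren⟧ f h (s ⊑ t) = ≡⇒ (cong₂ _⊑ᴹ_ (⟦renT⟧ f h s) (⟦renT⟧ f h t))
  ⟦ren⟧ f h (s ◁ t) = ≡⇒ (cong₂ _◁ᴹ_ (⟦renT⟧ f h s) (⟦renT⟧ f h t))
  ⟦ren⟧ f h (s ≐ t) = ≡⇒ (cong₂ _≡_ (⟦renT⟧ f h s) (⟦renT⟧ f h t))
  ⟦ren⟧ f h (At t)  = ≡⇒ (cong Atᴹ (⟦renT⟧ f h t))
  ⟦ren⟧ f h (φ ⇒ ψ)  = →-cong-⇔ (⟦ren⟧ f h φ) (⟦ren⟧ f h ψ)
  ⟦ren⟧ f h (φ ∧' ψ) = ⟦ren⟧ f h φ ×-⇔ ⟦ren⟧ f h ψ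
  ⟦ren⟧ f h (φ ∨' ψ) = ⟦ren⟧ f h φ ⊎-⇔ ⟦ren⟧ f h ψ
  ⟦ren⟧ f h (∀' φ) = Π-⇔ λ x → ⟦ren⟧ (liftR f) (∷-liftR x h) φ
  ⟦ren⟧ f h (∃' φ) = Σ-⇔ λ x → ⟦ren⟧ (liftR f) (∷-liftR x h) φ

  ⟦wkT⟧ : ∀ {n} x {ρ : Env n} t → ⟦ wkT t ⟧ᵗ (x ∷ ρ) ≡ ⟦ t ⟧ᵗ ρ
  ⟦wkT⟧ x (var i) = refl
  ⟦wkT⟧ x bot     = refl

  ∷-liftS : ∀ {n m} {σ : Fin n → Term m} {ρ : Env m} {ρ′ : Env n} x →
            (λ i → ⟦ σ i ⟧ᵗ ρ) ≗ lookup ρ′ →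
            (λ i → ⟦ liftS σ i ⟧ᵗ (x ∷ ρ)) ≗ lookup (x ∷ ρ′)
  ∷-liftS x h zero            = refl
  ∷-liftS {σ = σ} x h (suc i) = trans (⟦wkT⟧ x (σ i)) (h i)

  ⟦subT⟧ : ∀ {n m} (σ : Fin n → Term m) {ρ : Env m} {ρ′ : Env n} →
           (λ i → ⟦ σ i ⟧ᵗ ρ) ≗ lookup ρ′ → ∀ t → ⟦ subT σ t ⟧ᵗ ρ ≡ ⟦ t ⟧ᵗ ρ′
  ⟦subT⟧ σ σρ≗ρ′ (var i) = σρ≗ρ′ i
  ⟦subT⟧ σ σρ≗ρ′ bot     = refl

  ⟦sub⟧ : ∀ {n m} (σ : Fin n → Term m) {ρ : Env m} {ρ′ : Env n} →
          (λ i → ⟦ σ i ⟧ᵗ ρ) ≗ lookup ρ′ → ∀ φ → ⟦ sub σ φ ⟧ ρ ⇔ ⟦ φ ⟧ ρ′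
  ⟦sub⟧ σ h ff       = ⇔-id _
  ⟦sub⟧ σ h (s ⊑ t)  = ≡⇒ (cong₂ _⊑ᴹ_ (⟦subT⟧ σ h s) (⟦subT⟧ σ h t))
  ⟦sub⟧ σ h (s ◁ t)  = ≡⇒ (cong₂ _◁ᴹ_ (⟦subT⟧ σ h s) (⟦subT⟧ σ h t))
  ⟦sub⟧ σ h (s ≐ t)  = ≡⇒ (cong₂ _≡_ (⟦subT⟧ σ h s) (⟦subT⟧ σ h t))
  ⟦sub⟧ σ h (At t)   = ≡⇒ (cong Atᴹ (⟦subT⟧ σ h t))
  ⟦sub⟧ σ h (φ ⇒ ψ)  = →-cong-⇔ (⟦sub⟧ σ h φ) (⟦sub⟧ σ h ψ)
  ⟦sub⟧ σ h (φ ∧' ψ) = ⟦sub⟧ σ h φ ×-⇔ ⟦sub⟧ σ h ψ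
  ⟦sub⟧ σ h (φ ∨' ψ) = ⟦sub⟧ σ h φ ⊎-⇔ ⟦sub⟧ σ h ψ
  ⟦sub⟧ σ h (∀' φ)   = Π-⇔ λ x → ⟦sub⟧ (liftS σ) (∷-liftS x h) φ
  ⟦sub⟧ σ h (∃' φ)   = Σ-⇔ λ x → ⟦sub⟧ (liftS σ) (∷-liftS x h) φ

  ⟦emb⟧ : ∀ {n} {ρ : Env n} ψ → ⟦ emb ψ ⟧ ρ ⇔ ⟦ ψ ⟧ []
  ⟦emb⟧ = ⟦ren⟧ _ λ ()

  ⟦wk⟧ : ∀ {n} {ρ : Env n} x φ → ⟦ wk φ ⟧ (x ∷ ρ) ⇔ ⟦ φ ⟧ ρ
  ⟦wk⟧ x = ⟦ren⟧ suc λ _ → refl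

  wk-All : ∀ {n} {ρ : Env n} {Γ : List (Fm n)} x →
           All (λ γ → ⟦ γ ⟧ ρ) Γ → All (λ γ → ⟦ γ ⟧ (x ∷ ρ)) (map wk Γ)
  wk-All x ⊨Γ = map⁺ (All.map (λ {γ} → Equivalence.from (⟦wk⟧ x γ)) ⊨Γ)

  ⟦[]⟧ : ∀ {n} {ρ : Env n} φ t → ⟦ φ [ t ] ⟧ ρ ⇔ ⟦ φ ⟧ (⟦ t ⟧ᵗ ρ ∷ ρ)
  ⟦[]⟧ φ t = ⟦sub⟧ (sub0 t) sub0≗ φ
    where
    sub0≗ : (λ i → ⟦ sub0 t i ⟧ᵗ _) ≗ lookup (⟦ t ⟧ᵗ _ ∷ _)
    sub0≗ zero    = refl
    sub0≗ (suc i) = refl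

  soundness : ∀ {T n} {Γ : List (Fm n)} {φ} → (∀ {ψ} → T ψ → ⟦ ψ ⟧ []) →
              T ∣ Γ ⊢ φ → ∀ ρ → All (λ γ → ⟦ γ ⟧ ρ) Γ → ⟦ φ ⟧ ρ
  soundness ⊨T (hyp φ∈Γ)     ρ ⊨Γ = All.lookup ⊨Γ φ∈Γ
  soundness ⊨T (axiom {ψ = ψ} Tψ) ρ ⊨Γ = Equivalence.from (⟦emb⟧ ψ) (⊨T Tψ)
  soundness ⊨T (raa {φ = φ} d) ρ ⊨Γ = decidable-stable (⟦ φ ⟧? ρ) λ ¬φ → soundness ⊨T d ρ (¬φ ∷ ⊨Γ)
  soundness ⊨T (⇒I d)        ρ ⊨Γ = λ φ → soundness ⊨T d ρ (φ ∷ ⊨Γ)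
  soundness ⊨T (⇒E d e)      ρ ⊨Γ = soundness ⊨T d ρ ⊨Γ (soundness ⊨T e ρ ⊨Γ)
  soundness ⊨T (∧I d e)      ρ ⊨Γ = soundness ⊨T d ρ ⊨Γ , soundness ⊨T e ρ ⊨Γ
  soundness ⊨T (∧E₁ d)       ρ ⊨Γ = proj₁ (soundness ⊨T d ρ ⊨Γ)
  soundness ⊨T (∧E₂ d)       ρ ⊨Γ = proj₂ (soundness ⊨T d ρ ⊨Γ)
  soundness ⊨T (∨I₁ d)       ρ ⊨Γ = inj₁ (soundness ⊨T d ρ ⊨Γ)
  soundness ⊨T (∨I₂ d)       ρ ⊨Γ = inj₂ (soundness ⊨T d ρ ⊨Γ)
  soundness ⊨T (∨E d e f)    ρ ⊨Γ with soundness ⊨T d ρ ⊨Γ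
  ... | inj₁ φ = soundness ⊨T e ρ (φ ∷ ⊨Γ)
  ... | inj₂ ψ = soundness ⊨T f ρ (ψ ∷ ⊨Γ)
  soundness ⊨T (∀I d)        ρ ⊨Γ = λ x → soundness ⊨T d (x ∷ ρ) (wk-All x ⊨Γ)
  soundness ⊨T (∀E {φ = φ} d t) ρ ⊨Γ = Equivalence.from (⟦[]⟧ φ t) (soundness ⊨T d ρ ⊨Γ (⟦ t ⟧ᵗ ρ))
  soundness ⊨T (∃I {φ = φ} t d) ρ ⊨Γ = ⟦ t ⟧ᵗ ρ , Equivalence.to (⟦[]⟧ φ t) (soundness ⊨T d ρ ⊨Γ)
  soundness ⊨T (∃E {ψ = ψ} d e) ρ ⊨Γ with soundness ⊨T d ρ ⊨Γ
  ... | x , φx = Equivalence.to (⟦wk⟧ x ψ) (soundness ⊨T e (x ∷ ρ) (φx ∷ wk-All x ⊨Γ))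
  soundness ⊨T (≐refl t)     ρ ⊨Γ = refl
  soundness ⊨T (≐E {s = s} {t} φ d e) ρ ⊨Γ =
    Equivalence.from (⟦[]⟧ φ t)
      (subst (λ x → ⟦ φ ⟧ (x ∷ ρ)) (soundness ⊨T d ρ ⊨Γ)
        (Equivalence.to (⟦[]⟧ φ s) (soundness ⊨T e ρ ⊨Γ)))

_⊨_ : Structure → Theory → Set
𝔐 ⊨ T = ∀ {ψ} → T ψ → Semantics.⟦_⟧ 𝔐 ψ []

model⇒consistent : ∀ {T} 𝔐 → 𝔐 ⊨ T → Consistent T
model⇒consistent 𝔐 𝔐⊨T ⊢ff = Semantics.soundness 𝔐 𝔐⊨T ⊢ff [] []

-- Derivations use finitely many axioms

⊢-mono : ∀ {T U : Theory} {n} {Γ : List (Fm n)} {φ} →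
         (∀ {ψ} → T ψ → U ψ) → T ∣ Γ ⊢ φ → U ∣ Γ ⊢ φ
⊢-mono T⊆U (hyp φ∈Γ)   = hyp φ∈Γ
⊢-mono T⊆U (axiom Tψ)  = axiom (T⊆U Tψ)
⊢-mono T⊆U (raa d)     = raa (⊢-mono T⊆U d)
⊢-mono T⊆U (⇒I d)      = ⇒I (⊢-mono T⊆U d)
⊢-mono T⊆U (⇒E d e)    = ⇒E (⊢-mono T⊆U d) (⊢-mono T⊆U e)
⊢-mono T⊆U (∧I d e)    = ∧I (⊢-mono T⊆U d) (⊢-mono T⊆U e)
⊢-mono T⊆U (∧E₁ d)     = ∧E₁ (⊢-mono T⊆U d)
⊢-mono T⊆U (∧E₂ d)     = ∧E₂ (⊢-mono T⊆U d)
⊢-mono T⊆U (∨I₁ d)     = ∨I₁ (⊢-mono T⊆U d)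
⊢-mono T⊆U (∨I₂ d)     = ∨I₂ (⊢-mono T⊆U d)
⊢-mono T⊆U (∨E d e f)  = ∨E (⊢-mono T⊆U d) (⊢-mono T⊆U e) (⊢-mono T⊆U f)
⊢-mono T⊆U (∀I d)      = ∀I (⊢-mono T⊆U d)
⊢-mono T⊆U (∀E d t)    = ∀E (⊢-mono T⊆U d) t
⊢-mono T⊆U (∃I t d)    = ∃I t (⊢-mono T⊆U d)
⊢-mono T⊆U (∃E d e)    = ∃E (⊢-mono T⊆U d) (⊢-mono T⊆U e)
⊢-mono T⊆U (≐refl t)   = ≐refl t
⊢-mono T⊆U (≐E φ d e)  = ≐E φ (⊢-mono T⊆U d) (⊢-mono T⊆U e)

module _ (T : Theory) (rank : ∀ {ψ} → T ψ → ℕ) where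

  Fragment : ℕ → Theory
  Fragment B ψ = Σ (T ψ) λ Tψ → rank Tψ ≤ B

  private
    _⊢≤_ : ∀ {n} → List (Fm n) → Fm n → Set
    Γ ⊢≤ φ = ∃[ B ] (Fragment B ∣ Γ ⊢ φ)

    raise : ∀ {B B′ n} {Γ : List (Fm n)} {φ} → B ≤ B′ → Fragment B ∣ Γ ⊢ φ → Fragment B′ ∣ Γ ⊢ φ
    raise B≤B′ = ⊢-mono λ (Tψ , rank≤B) → Tψ , ≤-trans rank≤B B≤B′

    both : ∀ {n₁ n₂ n} {Γ₁ : List (Fm n₁)} {Γ₂ : List (Fm n₂)} {Γ : List (Fm n)} {φ₁ φ₂ φ} →
           (∀ {B} → Fragment B ∣ Γ₁ ⊢ φ₁ → Fragment B ∣ Γ₂ ⊢ φ₂ → Fragment B ∣ Γ ⊢ φ) →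
           Γ₁ ⊢≤ φ₁ → Γ₂ ⊢≤ φ₂ → Γ ⊢≤ φ
    both rule (B₁ , d₁) (B₂ , d₂) =
      B₁ ⊔ B₂ , rule (raise (m≤m⊔n B₁ B₂) d₁) (raise (m≤n⊔m B₁ B₂) d₂)

  ⊢-fragment : ∀ {n} {Γ : List (Fm n)} {φ} → T ∣ Γ ⊢ φ → ∃[ B ] (Fragment B ∣ Γ ⊢ φ)
  ⊢-fragment (hyp φ∈Γ)  = 0 , hyp φ∈Γ
  ⊢-fragment (axiom Tψ) = rank Tψ , axiom (Tψ , ≤-refl)
  ⊢-fragment (raa d)    = Product.map₂ raa (⊢-fragment d)
  ⊢-fragment (⇒I d)     = Product.map₂ ⇒I (⊢-fragment d)
  ⊢-fragment (⇒E d e)   = both ⇒E (⊢-fragment d) (⊢-fragment e)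
  ⊢-fragment (∧I d e)   = both ∧I (⊢-fragment d) (⊢-fragment e)
  ⊢-fragment (∧E₁ d)    = Product.map₂ ∧E₁ (⊢-fragment d)
  ⊢-fragment (∧E₂ d)    = Product.map₂ ∧E₂ (⊢-fragment d)
  ⊢-fragment (∨I₁ d)    = Product.map₂ ∨I₁ (⊢-fragment d)
  ⊢-fragment (∨I₂ d)    = Product.map₂ ∨I₂ (⊢-fragment d)
  ⊢-fragment (∨E d e f) with ⊢-fragment d | ⊢-fragment e | ⊢-fragment f
  ... | B₁ , d′ | B₂ , e′ | B₃ , f′ = B₁ ⊔ B₂ ⊔ B₃ ,
    ∨E (raise (≤-trans (m≤m⊔n B₁ B₂) (m≤m⊔n _ B₃)) d′)
       (raise (≤-trans (m≤n⊔m B₁ B₂) (m≤m⊔n _ B₃)) e′)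
       (raise (m≤n⊔m (B₁ ⊔ B₂) B₃) f′)
  ⊢-fragment (∀I d)     = Product.map₂ ∀I (⊢-fragment d)
  ⊢-fragment (∀E d t)   = Product.map₂ (λ d′ → ∀E d′ t) (⊢-fragment d)
  ⊢-fragment (∃I t d)   = Product.map₂ (∃I t) (⊢-fragment d)
  ⊢-fragment (∃E d e)   = both ∃E (⊢-fragment d) (⊢-fragment e)
  ⊢-fragment (≐refl t)  = 0 , ≐refl t
  ⊢-fragment (≐E φ d e) = both (≐E φ) (⊢-fragment d) (⊢-fragment e)

  fragments-consistent⇒consistent : (∀ B → Consistent (Fragment B)) → Consistent T
  fragments-consistent⇒consistent con ⊢ff with ⊢-fragment ⊢ff
  ... | B , ⊢ᴮff = con B ⊢ᴮff

-- Power sets of finite chains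

module _ {n : ℕ} where

  infix 4 _◁ˢ_

  _◁ˢ_ : Rel (Subset n) 0ℓ
  X ◁ˢ Y = ∃₂ λ i j → i ∈ X × j ∈ Y × i Fin.< j

  IsSingleton : Pred (Subset n) 0ℓ
  IsSingleton X = ∃ λ i → X ≡ ⁅ i ⁆

  toSubset : {P : Pred (Fin n) 0ℓ} → U.Decidable P → Subset n
  toSubset P? = tabulate (isYes ∘ P?)

  ∈-toSubset : ∀ {P : Pred (Fin n) 0ℓ} (P? : U.Decidable P) {i} → i ∈ toSubset P? ⇔ P i
  ∈-toSubset P? {i} = mk⇔
    (λ i∈ → toWitness (Equivalence.from Bool.T-≡ (trans (sym (lookup∘tabulate _ i)) ([]=⇒lookup i∈))))
    (λ Pi → lookup⇒[]= i _ (trans (lookup∘tabulate _ i) (Equivalence.to Bool.T-≡ (fromWitness Pi))))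

𝒫 : ℕ → Structure
𝒫 n = record
  { Carrier = Subset n
  ; ⊥ᴹ      = ∅
  ; _⊑ᴹ_    = _⊆_
  ; _◁ᴹ_    = _◁ˢ_
  ; Atᴹ     = IsSingleton
  ; _≐?_    = ≡-dec Bool._≟_
  ; _⊑?_    = _⊆?_
  ; _◁?_    = λ X Y → Fin.any? λ i → Fin.any? λ j → (i ∈? X) ×-dec (j ∈? Y) ×-dec (i Fin.<? j)
  ; At?     = λ X → Fin.any? λ i → ≡-dec Bool._≟_ X ⁅ i ⁆
  ; ∃?      = anySubset?
  }

module _ {n : ℕ} where

  ∈⇒⁅⁆⊆ : ∀ {i} {X : Subset n} → i ∈ X → ⁅ i ⁆ ⊆ X
  ∈⇒⁅⁆⊆ {i} {X} i∈X k∈⁅i⁆ = subst (_∈ X) (sym (x∈⁅y⁆⇒x≡y i k∈⁅i⁆)) i∈X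

  ⁅⁆⊆⇒∈ : ∀ {i} {X : Subset n} → ⁅ i ⁆ ⊆ X → i ∈ X
  ⁅⁆⊆⇒∈ {i} ⁅i⁆⊆X = ⁅i⁆⊆X (x∈⁅x⁆ i)

  ⁅⁆-injective : ∀ {i j : Fin n} → ⁅ i ⁆ ≡ ⁅ j ⁆ → i ≡ j
  ⁅⁆-injective {i} {j} ⁅i⁆≡⁅j⁆ = x∈⁅y⁆⇒x≡y j (subst (i ∈_) ⁅i⁆≡⁅j⁆ (x∈⁅x⁆ i))

  ⁅⁆≢∅ : ∀ {i : Fin n} → ⁅ i ⁆ ≢ ∅
  ⁅⁆≢∅ {i} ⁅i⁆≡∅ = ∉⊥ (subst (i ∈_) ⁅i⁆≡∅ (x∈⁅x⁆ i))

  ⁅⁆◁⁅⁆⇒< : ∀ {i j : Fin n} → ⁅ i ⁆ ◁ˢ ⁅ j ⁆ → i Fin.< j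
  ⁅⁆◁⁅⁆⇒< {i} {j} (i′ , j′ , i′∈ , j′∈ , i′<j′) =
    subst₂ Fin._<_ (x∈⁅y⁆⇒x≡y i i′∈) (x∈⁅y⁆⇒x≡y j j′∈) i′<j′

  <⇒⁅⁆◁⁅⁆ : ∀ {i j : Fin n} → i Fin.< j → ⁅ i ⁆ ◁ˢ ⁅ j ⁆
  <⇒⁅⁆◁⁅⁆ {i} {j} i<j = i , j , x∈⁅x⁆ i , x∈⁅x⁆ j , i<j

least-element : ∀ {n} (X : Subset n) → Nonempty X → ∃ λ i → i ∈ X × ∀ {j} → j ∈ X → i Fin.≤ j
least-element (inside ∷ X)  _                     = zero , here , λ _ → z≤n
least-element (outside ∷ X) (suc i , there i∈X) with least-element X (i , i∈X)
... | k , k∈X , k≤ = suc k , there k∈X , suc-least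
  where
  suc-least : ∀ {j} → j ∈ outside ∷ X → suc k Fin.≤ j
  suc-least (there j∈X) = s≤s (k≤ j∈X)

module _ {n : ℕ} where

  nonempty : {X : Subset n} → X ≢ ∅ → Nonempty X
  nonempty {X} X≢∅ with nonempty? X
  ... | yes ne   = ne
  ... | no empty = contradiction (Empty-unique empty) X≢∅

  IsAtom : Pred (Subset n) 0ℓ
  IsAtom X = X ≢ ∅ × ∀ Z → Z ⊆ X → Z ≡ ∅ ⊎ Z ≡ X

  singleton⇒atom : ∀ {X} → IsSingleton X → IsAtom X
  singleton⇒atom (i , refl) = ⁅⁆≢∅ , below
    where
    below : ∀ Z → Z ⊆ ⁅ i ⁆ → Z ≡ ∅ ⊎ Z ≡ ⁅ i ⁆
    below Z Z⊆⁅i⁆ with i ∈? Z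
    ... | yes i∈Z = inj₂ (⊆-antisym Z⊆⁅i⁆ (∈⇒⁅⁆⊆ i∈Z))
    ... | no  i∉Z =
      inj₁ (Empty-unique λ (j , j∈Z) → i∉Z (subst (_∈ Z) (x∈⁅y⁆⇒x≡y i (Z⊆⁅i⁆ j∈Z)) j∈Z))

  atom⇒singleton : ∀ {X} → IsAtom X → IsSingleton X
  atom⇒singleton (X≢∅ , below) with nonempty X≢∅
  ... | i , i∈X with below ⁅ i ⁆ (∈⇒⁅⁆⊆ i∈X)
  ...   | inj₁ ⁅i⁆≡∅ = contradiction ⁅i⁆≡∅ ⁅⁆≢∅
  ...   | inj₂ ⁅i⁆≡X = i , sym ⁅i⁆≡X

  IsMeet IsJoin : Subset n → Subset n → Subset n → Set
  IsMeet X Y Z = Z ⊆ X × Z ⊆ Y × ∀ W → W ⊆ X × W ⊆ Y → W ⊆ Z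
  IsJoin X Y Z = X ⊆ Z × Y ⊆ Z × ∀ W → X ⊆ W × Y ⊆ W → Z ⊆ W

  ∩-isMeet : ∀ X Y → IsMeet X Y (X ∩ Y)
  ∩-isMeet X Y = p∩q⊆p X Y , p∩q⊆q X Y , λ W (W⊆X , W⊆Y) i∈W → x∈p∩q⁺ (W⊆X i∈W , W⊆Y i∈W)

  ∪-isJoin : ∀ X Y → IsJoin X Y (X ∪ Y)
  ∪-isJoin X Y =
    p⊆p∪q Y , q⊆p∪q X Y , λ W (X⊆W , Y⊆W) i∈X∪Y → [ X⊆W , Y⊆W ]′ (x∈p∪q⁻ X Y i∈X∪Y)

  isMeet⇒≡∩ : ∀ {X Y Z} → IsMeet X Y Z → Z ≡ X ∩ Y
  isMeet⇒≡∩ {X} {Y} {Z} (Z⊆X , Z⊆Y , glb) =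
    ⊆-antisym (proj₂ (proj₂ (∩-isMeet X Y)) Z (Z⊆X , Z⊆Y)) (glb (X ∩ Y) (p∩q⊆p X Y , p∩q⊆q X Y))

  isJoin⇒≡∪ : ∀ {X Y Z} → IsJoin X Y Z → Z ≡ X ∪ Y
  isJoin⇒≡∪ {X} {Y} {Z} (X⊆Z , Y⊆Z , lub) =
    ⊆-antisym (lub (X ∪ Y) (p⊆p∪q Y , q⊆p∪q X Y)) (proj₂ (proj₂ (∪-isJoin X Y)) Z (X⊆Z , Y⊆Z))

module BaseAxioms (n : ℕ) where
  open Semantics (𝒫 n)

  ⊨ax-distr : ⟦ ax-distr ⟧ []
  ⊨ax-distr X Y Z J M M₁ M₂ J₂ (J=Y∪Z , M=X∩J , M₁=X∩Y , M₂=X∩Z , J₂=M₁∪M₂) = begin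
    M                   ≡⟨ isMeet⇒≡∩ M=X∩J ⟩
    X ∩ J               ≡⟨ cong (X ∩_) (isJoin⇒≡∪ J=Y∪Z) ⟩
    X ∩ (Y ∪ Z)         ≡⟨ ∩-distribˡ-∪ X Y Z ⟩
    (X ∩ Y) ∪ (X ∩ Z)   ≡⟨ cong₂ _∪_ (isMeet⇒≡∩ M₁=X∩Y) (isMeet⇒≡∩ M₂=X∩Z) ⟨
    M₁ ∪ M₂             ≡⟨ isJoin⇒≡∪ J₂=M₁∪M₂ ⟨
    J₂                  ∎
    where open ≡-Reasoning

  ⊨ax-compl : ⟦ ax-compl ⟧ []
  ⊨ax-compl X = ∁ X , subst (IsMeet X (∁ X)) (∩-inverseʳ X) (∩-isMeet X (∁ X)) ,
                ⊤ , (λ _ → ⊆⊤) , subst (IsJoin X (∁ X)) (∪-inverseʳ X) (∪-isJoin X (∁ X))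

  ⊨ax-atomic : ⟦ ax-atomic ⟧ []
  ⊨ax-atomic X X≢∅ with nonempty X≢∅
  ... | i , i∈X = ⁅ i ⁆ , singleton⇒atom (i , refl) , ∈⇒⁅⁆⊆ i∈X

  ⊨ax-total : ⟦ ax-total ⟧ []
  ⊨ax-total _ (i , refl) _ (j , refl) with Fin.<-cmp i j
  ... | tri< i<j _ _ = inj₁ (<⇒⁅⁆◁⁅⁆ i<j)
  ... | tri≈ _ refl _ = inj₂ (inj₁ refl)
  ... | tri> _ _ j<i = inj₂ (inj₂ (<⇒⁅⁆◁⁅⁆ j<i))

  ⊨ax-lift : ⟦ ax-lift ⟧ []
  ⊨ax-lift X Y = split , join
    where
    Witnessed : Set
    Witnessed = ⟦ ∃a (∃a (x1 ⊑ x3 ∧' x0 ⊑ x2 ∧' x1 ◁ x0)) ⟧ (Y ∷ X ∷ [])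
    split : X ◁ˢ Y → Witnessed
    split (i , j , i∈X , j∈Y , i<j) =
      ⁅ i ⁆ , (i , refl) , ⁅ j ⁆ , (j , refl) , ∈⇒⁅⁆⊆ i∈X , ∈⇒⁅⁆⊆ j∈Y , <⇒⁅⁆◁⁅⁆ i<j
    join : Witnessed → X ◁ˢ Y
    join (_ , (i , refl) , _ , (j , refl) , ⁅i⁆⊆X , ⁅j⁆⊆Y , i◁j) =
      i , j , ⁅⁆⊆⇒∈ ⁅i⁆⊆X , ⁅⁆⊆⇒∈ ⁅j⁆⊆Y , ⁅⁆◁⁅⁆⇒< i◁j

  ⊨comprehension : ∀ k η → ⟦ comprehension k η ⟧ []
  ⊨comprehension k η = closeAll-intro k λ ρ → X ρ , defines ρ
    where
    X : Env k → Subset n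
    X ρ = toSubset λ i → ⟦ η ⟧? (⁅ i ⁆ ∷ ρ)
    compRen≗ : ∀ x ρ → lookup (x ∷ X ρ ∷ ρ) ∘ compRen ≗ lookup (x ∷ ρ)
    compRen≗ x ρ zero    = refl
    compRen≗ x ρ (suc i) = refl
    defines : ∀ ρ x → IsSingleton x → ⟦ x0 ⊑ x1 Defs.⇔ ren compRen η ⟧ (x ∷ X ρ ∷ ρ)
    defines ρ _ (i , refl) = Equivalence.to ⁅i⁆⊆X⇔η , Equivalence.from ⁅i⁆⊆X⇔η
      where
      ⁅i⁆⊆X⇔η : ⁅ i ⁆ ⊆ X ρ ⇔ ⟦ ren compRen η ⟧ (⁅ i ⁆ ∷ X ρ ∷ ρ)
      ⁅i⁆⊆X⇔η = ⇔.trans (mk⇔ ⁅⁆⊆⇒∈ ∈⇒⁅⁆⊆)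
                  (⇔.trans (∈-toSubset _) (⇔.sym (⟦ren⟧ compRen (compRen≗ _ ρ) η)))

  ⊨T-base : ∀ {ψ} → T-base ψ → ⟦ ψ ⟧ []
  ⊨T-base b-refl    X = ⊆-refl
  ⊨T-base b-antisym X Y (X⊆Y , Y⊆X) = ⊆-antisym X⊆Y Y⊆X
  ⊨T-base b-trans   X Y Z (X⊆Y , Y⊆Z) = ⊆-trans X⊆Y Y⊆Z
  ⊨T-base b-meet    X Y = X ∩ Y , ∩-isMeet X Y
  ⊨T-base b-join    X Y = X ∪ Y , ∪-isJoin X Y
  ⊨T-base b-top     = ⊤ , λ _ → ⊆⊤
  ⊨T-base b-bot     X = ⊥⊆
  ⊨T-base b-distr   = ⊨ax-distr
  ⊨T-base b-compl   = ⊨ax-compl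
  ⊨T-base b-atomic  = ⊨ax-atomic
  ⊨T-base b-At      X = singleton⇒atom , atom⇒singleton
  ⊨T-base b-irrefl  _ (i , refl) i◁i = Fin.<-irrefl refl (⁅⁆◁⁅⁆⇒< i◁i)
  ⊨T-base b-ltrans  _ (i , refl) _ (j , refl) _ (k , refl) (i◁j , j◁k) =
    <⇒⁅⁆◁⁅⁆ (Fin.<-trans (⁅⁆◁⁅⁆⇒< i◁j) (⁅⁆◁⁅⁆⇒< j◁k))
  ⊨T-base b-total   = ⊨ax-total
  ⊨T-base b-lift    = ⊨ax-lift
  ⊨T-base (b-comp k η) = ⊨comprehension k η

module _ {n : ℕ} where

  ≤⇒<⊎≡ : ∀ {i j : Fin n} → i Fin.≤ j → i Fin.< j ⊎ i ≡ j
  ≤⇒<⊎≡ i≤j = Sum.map₂ Fin.toℕ-injective (m≤n⇒m<n∨m≡n i≤j)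

  IsSuccˢ : Subset n → Subset n → Set
  IsSuccˢ X Y = IsSingleton X × IsSingleton Y × X ◁ˢ Y × ∀ Z → IsSingleton Z → ¬ (X ◁ˢ Z × Z ◁ˢ Y)

  ⁅⁆-isSucc : ∀ {i j : Fin n} → toℕ j ≡ suc (toℕ i) → IsSuccˢ ⁅ i ⁆ ⁅ j ⁆
  ⁅⁆-isSucc {i} {j} j≡1+i =
    (i , refl) , (j , refl) , <⇒⁅⁆◁⁅⁆ (≤-reflexive (sym j≡1+i)) , nothing-between
    where
    nothing-between : ∀ Z → IsSingleton Z → ¬ (⁅ i ⁆ ◁ˢ Z × Z ◁ˢ ⁅ j ⁆)
    nothing-between _ (k , refl) (i◁k , k◁j) =
      <⇒≱ (⁅⁆◁⁅⁆⇒< i◁k) (s≤s⁻¹ (subst (suc (toℕ k) ≤_) j≡1+i (⁅⁆◁⁅⁆⇒< k◁j)))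

  isSucc-⁅⁆ : ∀ {i j : Fin n} → IsSuccˢ ⁅ i ⁆ ⁅ j ⁆ → toℕ j ≡ suc (toℕ i)
  isSucc-⁅⁆ {i} {j} (_ , _ , i◁j , nothing-between) with m≤n⇒m<n∨m≡n (⁅⁆◁⁅⁆⇒< i◁j)
  ... | inj₂ 1+i≡j = sym 1+i≡j
  ... | inj₁ 1+i<j = contradiction (<⇒⁅⁆◁⁅⁆ i<k , <⇒⁅⁆◁⁅⁆ k<j)
                                   (nothing-between ⁅ k ⁆ (k , refl))
    where
    k : Fin n
    k = Fin.fromℕ< (<-trans 1+i<j (Fin.toℕ<n j))
    i<k : i Fin.< k
    i<k = ≤-reflexive (sym (Fin.toℕ-fromℕ< _))
    k<j : k Fin.< j
    k<j = subst (_< toℕ j) (sym (Fin.toℕ-fromℕ< _)) 1+i<j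

module FinAxioms (M : ℕ) where
  open Semantics (𝒫 (suc M))

  ⊨ax-least : ⟦ ax-least ⟧ []
  ⊨ax-least = ⁅ zero ⁆ , (zero , refl) , least
    where
    least : ∀ Y → IsSingleton Y → Y ≡ ⁅ zero ⁆ ⊎ ⁅ zero ⁆ ◁ˢ Y
    least _ (zero  , refl) = inj₁ refl
    least _ (suc i , refl) = inj₂ (<⇒⁅⁆◁⁅⁆ z<s)

  ⊨ax-greatest : ⟦ ax-greatest ⟧ []
  ⊨ax-greatest = ⁅ Fin.fromℕ M ⁆ , (Fin.fromℕ M , refl) , greatest
    where
    greatest : ∀ Y → IsSingleton Y → Y ≡ ⁅ Fin.fromℕ M ⁆ ⊎ Y ◁ˢ ⁅ Fin.fromℕ M ⁆
    greatest _ (i , refl) with ≤⇒<⊎≡ (Fin.≤fromℕ i)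
    ... | inj₁ i<M = inj₂ (<⇒⁅⁆◁⁅⁆ i<M)
    ... | inj₂ refl = inj₁ refl

  ⊨ax-succ : ⟦ ax-succ ⟧ []
  ⊨ax-succ _ (i , refl) (_ , (j , refl) , i◁j) = ⁅ k ⁆ , ⁅⁆-isSucc (Fin.toℕ-fromℕ< 1+i<1+M)
    where
    1+i<1+M : suc (toℕ i) < suc M
    1+i<1+M = ≤-<-trans (⁅⁆◁⁅⁆⇒< i◁j) (Fin.toℕ<n j)
    k : Fin (suc M)
    k = Fin.fromℕ< 1+i<1+M

  ⊨ax-pred : ⟦ ax-pred ⟧ []
  ⊨ax-pred _ (zero  , refl) (_ , (j , refl) , j◁0) = contradiction (⁅⁆◁⁅⁆⇒< j◁0) n≮0
  ⊨ax-pred _ (suc i , refl) _ = ⁅ Fin.inject₁ i ⁆ , ⁅⁆-isSucc (cong suc (sym (Fin.toℕ-inject₁ i)))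

  ⊨ax-wf : ⟦ ax-wf ⟧ []
  ⊨ax-wf X X≢∅ with least-element X (nonempty X≢∅)
  ... | i , i∈X , i-least = ⁅ i ⁆ , (i , refl) , ∈⇒⁅⁆⊆ i∈X , least
    where
    least : ∀ Y → IsSingleton Y → Y ⊆ X → Y ≡ ⁅ i ⁆ ⊎ ⁅ i ⁆ ◁ˢ Y
    least _ (j , refl) ⁅j⁆⊆X with ≤⇒<⊎≡ (i-least (⁅⁆⊆⇒∈ ⁅j⁆⊆X))
    ... | inj₁ i<j  = inj₂ (<⇒⁅⁆◁⁅⁆ i<j)
    ... | inj₂ refl = inj₁ refl

  ⊨T-MSOFin : ∀ {ψ} → T-MSOFin ψ → ⟦ ψ ⟧ []
  ⊨T-MSOFin (m-base ψ) = BaseAxioms.⊨T-base (suc M) ψ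
  ⊨T-MSOFin m-least    = ⊨ax-least
  ⊨T-MSOFin m-greatest = ⊨ax-greatest
  ⊨T-MSOFin m-succ     = ⊨ax-succ
  ⊨T-MSOFin m-pred     = ⊨ax-pred
  ⊨T-MSOFin m-wf       = ⊨ax-wf

  ⊨atLeast : ∀ {k} → k ≤ M → ⟦ atLeast k ⟧ []
  ⊨atLeast {k} k≤M = exAll-intro (suc k) atoms
    (⋀-intro (At ∘ var) (λ i → embed i , lookup-atoms i) ,
     ⋀-intro (λ i → ⋀ λ j → ¬' (var i ≐ var (Fin.punchIn i j))) λ i →
       ⋀-intro (λ j → ¬' (var i ≐ var (Fin.punchIn i j))) (distinct i))
    where
    embed : Fin (suc k) → Fin (suc M)
    embed i = Fin.inject≤ i (s≤s k≤M)
    atoms : Vec (Subset (suc M)) (suc k)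
    atoms = tabulate (⁅_⁆ ∘ embed)
    lookup-atoms : ∀ i → lookup atoms i ≡ ⁅ embed i ⁆
    lookup-atoms = lookup∘tabulate (⁅_⁆ ∘ embed)
    distinct : ∀ i j → lookup atoms i ≢ lookup atoms (Fin.punchIn i j)
    distinct i j eq = Fin.punchInᵢ≢i i j (sym (Fin.inject≤-injective _ _ i _
      (⁅⁆-injective (trans (sym (lookup-atoms i)) (trans eq (lookup-atoms _))))))

  least-atom : ∀ {a : Fin (suc M)} →
               (∀ Y → IsSingleton Y → Y ≡ ⁅ a ⁆ ⊎ ⁅ a ⁆ ◁ˢ Y) → a ≡ zero
  least-atom least with least ⁅ zero ⁆ (zero , refl)
  ... | inj₁ ⁅0⁆≡⁅a⁆ = sym (⁅⁆-injective ⁅0⁆≡⁅a⁆)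
  ... | inj₂ a◁0     = contradiction (⁅⁆◁⁅⁆⇒< a◁0) n≮0

  greatest-atom : ∀ {a : Fin (suc M)} →
                  (∀ Y → IsSingleton Y → Y ≡ ⁅ a ⁆ ⊎ Y ◁ˢ ⁅ a ⁆) → a ≡ Fin.fromℕ M
  greatest-atom greatest with greatest ⁅ Fin.fromℕ M ⁆ (Fin.fromℕ M , refl)
  ... | inj₁ ⁅M⁆≡⁅a⁆ = sym (⁅⁆-injective ⁅M⁆≡⁅a⁆)
  ... | inj₂ M◁a     = contradiction (Fin.≤fromℕ _) (<⇒≱ (⁅⁆◁⁅⁆⇒< M◁a))

-- With d = suc m, atom a gets colour a mod d, i.e. lies in the paper's A_{(a mod d)+1};
-- rhoIdx m h is the 0-based colour of A_h.
module Residues (m M : ℕ) where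

  class : Fin (suc M) → Fin (suc m)
  class a = toℕ a mod suc m

  classOf : Fin (suc m) → Subset (suc M)
  classOf i = toSubset λ a → class a Fin.≟ i

  classes : Vec (Subset (suc M)) (suc m)
  classes = tabulate classOf

  ∈-classes : ∀ {a i} → a ∈ lookup classes i ⇔ class a ≡ i
  ∈-classes {a} {i} rewrite lookup∘tabulate classOf i = ∈-toSubset λ a → class a Fin.≟ i

  class-inject≤ : ∀ (i : Fin (suc m)) (m≤M : m ≤ M) → class (Fin.inject≤ i (s≤s m≤M)) ≡ i
  class-inject≤ i m≤M = Fin.toℕ-injective (begin
    toℕ (class (Fin.inject≤ i _)) ≡⟨ Fin.toℕ-fromℕ< _ ⟩
    toℕ (Fin.inject≤ i _) % suc m ≡⟨ cong (_% suc m) (Fin.toℕ-inject≤ i _) ⟩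
    toℕ i % suc m                 ≡⟨ m<n⇒m%n≡m (Fin.toℕ<n i) ⟩
    toℕ i                         ∎)
    where open ≡-Reasoning

  class-suc : ∀ {a b} → toℕ b ≡ suc (toℕ a) → class b ≡ nextIdx (class a)
  class-suc {a} {b} b≡1+a = Fin.toℕ-injective (begin
    toℕ (class b)               ≡⟨ Fin.toℕ-fromℕ< _ ⟩
    toℕ b % suc m               ≡⟨ cong (_% suc m) b≡1+a ⟩
    suc (toℕ a) % suc m         ≡⟨ %-cong-+ˡ 1 (suc m) (m%n%n≡m%n (toℕ a) (suc m)) ⟨
    suc (toℕ a % suc m) % suc m ≡⟨ cong (λ r → suc r % suc m) (Fin.toℕ-fromℕ< _) ⟨
    suc (toℕ (class a)) % suc m ≡⟨ Fin.toℕ-fromℕ< _ ⟨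
    toℕ (nextIdx (class a))     ∎)
    where open ≡-Reasoning

  class-last : ∀ h → suc M % suc m ≡ h % suc m → class (Fin.fromℕ M) ≡ rhoIdx m h
  class-last h 1+M≡h = Fin.toℕ-injective (begin
    toℕ (class (Fin.fromℕ M)) ≡⟨ Fin.toℕ-fromℕ< _ ⟩
    toℕ (Fin.fromℕ M) % suc m ≡⟨ cong (_% suc m) (Fin.toℕ-fromℕ M) ⟩
    M % suc m                 ≡⟨ [m+n]%n≡m%n M (suc m) ⟨
    (M + suc m) % suc m       ≡⟨ cong (_% suc m) (M+1+m≡m+1+M) ⟩
    (m + suc M) % suc m       ≡⟨ %-cong-+ˡ m (suc m) 1+M≡h ⟩
    (m + h) % suc m           ≡⟨ cong (_% suc m) (+-comm m h) ⟩
    (h + m) % suc m           ≡⟨ Fin.toℕ-fromℕ< _ ⟨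
    toℕ (rhoIdx m h)          ∎)
    where
    open ≡-Reasoning
    M+1+m≡m+1+M : M + suc m ≡ m + suc M
    M+1+m≡m+1+M = trans (+-suc M m) (trans (cong suc (+-comm M m)) (sym (+-suc m M)))

  open Semantics (𝒫 (suc M))
  open FinAxioms M using (least-atom; greatest-atom)

  ⊨rho : ∀ h → m ≤ M → suc M % suc m ≡ h % suc m → ⟦ rho m h ⟧ []
  ⊨rho h m≤M 1+M≡h = exAll-intro (suc m) classes
    ( ⋀-intro (λ i → ¬' (var i ≐ bot)) nonempty-class
    , (λ { _ (a , refl) → ⋁-intro (λ i → x0 ⊑ var (suc i)) (class a , from ⁅⁆⊆class refl) })
    , (λ { _ (a , refl) → ⋀-intro (⋀ ∘ disjoint) {⁅ a ⁆ ∷ classes} λ i →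
           ⋀-intro (disjoint i) λ j (a∈i , a∈j) →
           Fin.punchInᵢ≢i i j (trans (sym (to ⁅⁆⊆class a∈j)) (to ⁅⁆⊆class a∈i)) })
    , (λ { _ ((a , refl) , least) → from ⁅⁆⊆class (cong class (least-atom least)) })
    , (λ { _ (a , refl) _ (b , refl) a→b → ⋀-intro step {⁅ b ⁆ ∷ ⁅ a ⁆ ∷ classes} λ i a∈i →
           from ⁅⁆⊆class (trans (class-suc (isSucc-⁅⁆ a→b)) (cong nextIdx (to ⁅⁆⊆class a∈i))) })
    , (λ { _ ((a , refl) , greatest) →
           from ⁅⁆⊆class (trans (cong class (greatest-atom greatest)) (class-last h 1+M≡h)) }))
    where
    open Equivalence
    disjoint : Fin (suc m) → Fin m → Fm (2 + m)
    disjoint i j = ¬' (x0 ⊑ var (suc i) ∧' x0 ⊑ var (suc (Fin.punchIn i j)))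
    step : Fin (suc m) → Fm (3 + m)
    step i = x1 ⊑ var (suc (suc i)) ⇒ x0 ⊑ var (suc (suc (nextIdx i)))
    ⁅⁆⊆class : ∀ {a i} → ⁅ a ⁆ ⊆ lookup classes i ⇔ class a ≡ i
    ⁅⁆⊆class = ⇔.trans (mk⇔ ⁅⁆⊆⇒∈ ∈⇒⁅⁆⊆) ∈-classes
    nonempty-class : ∀ i → lookup classes i ≢ ∅
    nonempty-class i eq = ∉⊥ (subst (Fin.inject≤ i (s≤s m≤M) ∈_) eq (from ∈-classes (class-inject≤ i m≤M)))

-- Finite fragments of T_r̃

rank : ∀ {rt ψ} → T-res rt ψ → ℕ
rank (t-mso _) = 0
rank (t-inf n) = n
rank (t-rho k) = k

fragment-model : ∀ {rt} B M → B < M → (∀ k → k ≤ B → suc M % (2 + k) ≡ rt (2 + k) % (2 + k)) →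
                 𝒫 (suc M) ⊨ Fragment (T-res rt) rank B
fragment-model B M B<M congruent (t-mso ψ , _)   = FinAxioms.⊨T-MSOFin M ψ
fragment-model B M B<M congruent (t-inf n , n≤B) = FinAxioms.⊨atLeast M (≤-trans n≤B (<⇒≤ B<M))
fragment-model {rt} B M B<M congruent (t-rho k , k≤B) =
  Residues.⊨rho (suc k) M (rt (2 + k)) (≤-trans (s≤s k≤B) B<M) (congruent k k≤B)

T-res-fragment-model : ∀ {rt} → IsResidueFunction rt →
                       ∀ B → ∃[ M ] 𝒫 (suc M) ⊨ Fragment (T-res rt) rank B
T-res-fragment-model {rt} res B = pred N , fragment-model B (pred N) B<pred[N] congruent
  where
  D N : ℕ
  D = (2 + B) !
  N = rt D + D
  instance
    D≢0 : NonZero D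
    D≢0 = (2 + B) !≢0
  d∣D : ∀ k → k ≤ B → 2 + k ∣ D
  d∣D k k≤B = ∣-trans (m∣m*n ((1 + k) !)) (m≤n⇒m!∣n! (s≤s (s≤s k≤B)))
  2+B≤D : 2 + B ≤ D
  2+B≤D = ∣⇒≤ (d∣D B ≤-refl)
  1<D : 1 < D
  1<D = ≤-trans (s≤s (s≤s z≤n)) 2+B≤D
  2+B≤N : 2 + B ≤ N
  2+B≤N = ≤-trans 2+B≤D (m≤n+m D (rt D))
  instance
    N≢0 : NonZero N
    N≢0 = >-nonZero (≤-trans (s≤s z≤n) 2+B≤N)
  B<pred[N] : B < pred N
  B<pred[N] = pred-mono-≤ 2+B≤N
  congruent : ∀ k → k ≤ B → suc (pred N) % (2 + k) ≡ rt (2 + k) % (2 + k)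
  congruent k k≤B = begin
    suc (pred N) % (2 + k) ≡⟨ cong (_% (2 + k)) (suc-pred N) ⟩
    (rt D + D) % (2 + k)   ≡⟨ %-remove-+ʳ (rt D) (d∣D k k≤B) ⟩
    rt D % (2 + k)         ≡⟨ residue-coherent res (s≤s (s≤s z≤n)) 1<D (d∣D k k≤B) ⟩
    rt (2 + k) % (2 + k)   ∎
    where open ≡-Reasoning

proposition4p13 : (rt : ℕ → ℕ) → IsResidueFunction rt → Consistent (T-res rt)
proposition4p13 rt res = fragments-consistent⇒consistent (T-res rt) rank λ B →
  let M , 𝒫⊨T-resᴮ = T-res-fragment-model res B in model⇒consistent (𝒫 (suc M)) 𝒫⊨T-resᴮ
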